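{- For all integers $n\ge t\ge2$, $\operatorname{fdim}_t(\mathbf{n})=\dfrac{n-1}{t-1}$, where $\mathbf{n}$ is the $n$-element chain.
   Context: $\mathbf{m}$ denotes the $m$-element chain. A function $f:P\to\mathbf{t}$ is monotone if $x\le y$ implies $f(x)\le f(y)$. A fractional $t$-realiser of a finite poset $P$ is a function $w$ assigning a nonnegative real weight to each monotone (total) function $f:P\to\mathbf{t}$ such that for every pair $x,y\in P$ with $x\not\ge y$, $\sum\{w(f): f(x)<f(y)\}\ge1$. The fractional $t$-dimension $\operatorname{fdim}_t(P)$ is the minimum over all fractional $t$-realisers $w$ of the total weight $\sum_f w(f)$.
   Formalization: The weights of a fractional $t$-realiser are nonnegative rationals instead of nonnegative reals. -}

module Defs where

open import Data.Nat as ℕ using (ℕ; zero; suc; _∸_; z≤n; s≤s)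
open import Data.Fin as Fin using (Fin; _≤_; _<_)
open import Data.Fin.Properties using (all?) renaming (_≤?_ to _≤ᶠ?_; _<?_ to _<ᶠ?_)
open import Data.List using (List; []; _∷_; map; concatMap; filter; foldr; allFin)
open import Data.Integer using (+_)
open import Data.Rational using (ℚ; 0ℚ; 1ℚ; _+_; _/_) renaming (_≤_ to _≤ℚ_)
open import Data.Product using (Σ; _×_)
open import Relation.Nullary using (Dec; ¬_)
open import Relation.Nullary.Decidable using (_→-dec_)

-- The m-element chain is Fin m with its usual order.
-- A function f : chain n → chain t is monotone.
Monotone : ∀ {n t} → (Fin n → Fin t) → Set
Monotone {n} f = ∀ (x y : Fin n) → x ≤ y → f x ≤ f y

monotone? : ∀ {n t} (f : Fin n → Fin t) → Dec (Monotone f)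
monotone? f = all? λ x → all? λ y → (x ≤ᶠ? y) →-dec (f x ≤ᶠ? f y)

cons : ∀ {n t} → Fin t → (Fin n → Fin t) → Fin (suc n) → Fin t
cons i g Fin.zero    = i
cons i g (Fin.suc x) = g x

allFuns : ∀ n t → List (Fin n → Fin t)
allFuns zero    t = (λ ()) ∷ []
allFuns (suc n) t = concatMap (λ i → map (cons i) (allFuns n t)) (allFin t)

monoFuns : ∀ n t → List (Fin n → Fin t)
monoFuns n t = filter monotone? (allFuns n t)

sumℚ : List ℚ → ℚ
sumℚ = foldr _+_ 0ℚ

-- A weighting: its values on non-monotone functions are ignored.
Weighting : ℕ → ℕ → Set
Weighting n t = (Fin n → Fin t) → ℚ

totalWeight : ∀ {n t} → Weighting n t → ℚ
totalWeight {n} {t} w = sumℚ (map w (monoFuns n t))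

weightSep : ∀ {n t} → Weighting n t → Fin n → Fin n → ℚ
weightSep {n} {t} w x y = sumℚ (map w (filter (λ f → f x <ᶠ? f y) (monoFuns n t)))

IsFracRealiser : ∀ n t → Weighting n t → Set
IsFracRealiser n t w =
  (∀ f → Monotone f → 0ℚ ≤ℚ w f) ×
  (∀ (x y : Fin n) → ¬ (y ≤ x) → 1ℚ ≤ℚ weightSep w x y)

IsFdim : ℕ → ℕ → ℚ → Set
IsFdim n t q =
  Σ (Weighting n t) (λ w → IsFracRealiser n t w × totalWeight w ≡ q) ×
  (∀ w → IsFracRealiser n t w → q ≤ℚ totalWeight w)
  where open import Relation.Binary.PropositionalEquality using (_≡_)

nonZeroPred : ∀ {t} → 2 ℕ.≤ t → ℕ.NonZero (t ∸ 1)
nonZeroPred {suc (suc k)} (s≤s (s≤s z≤n)) = _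

ratio : (n t : ℕ) → 2 ℕ.≤ t → ℚ
ratio n t h = _/_ (+ (n ∸ 1)) (t ∸ 1) {{nonZeroPred h}}

{-# OPTIONS --safe #-}
-- Write n = m + 1 and t = s + 1.
--
-- Lower bound: a monotone map from the (m+1)-chain to the (s+1)-chain rises strictly on at most s of the
-- m consecutive pairs (i, i+1), while a fractional realiser gives weight at least 1 to each such pair.
-- Double counting gives m ≤ s · (total weight).
--
-- Upper bound: give weight 1/s to each of the m staircase maps x ↦ ⌊(x s + j)/m⌋, 0 ≤ j < m; their total
-- weight is m/s. Each of them rises by 0 or 1 from x to x + 1, and by Hermite's identity
-- ∑_{j<m} ⌊(a + j)/m⌋ = a their values at x sum to x s, so exactly s of them rise between x and x + 1;
-- hence every pair x < y is separated with weight s · (1/s) = 1.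
module Submission where

open import Defs

open import Algebra.Bundles using (CommutativeRing; Semiring)
import Algebra.Properties.Semiring.Sum as SemiringSum
open import Data.Empty using (⊥-elim)
open import Data.Fin as Fin using (Fin; zero; suc; toℕ; inject₁; fromℕ; fromℕ<)
import Data.Fin.Properties as Fin
open import Data.Integer as ℤ using (+_)
import Data.Integer.Properties as ℤ
open import Data.Integer.Tactic.RingSolver using (solve-∀)
open import Data.List using (List; []; _∷_; _++_; map; filter; concatMap; tabulate; allFin)
import Data.List.Properties as List
open import Data.List.Relation.Unary.All as All using (All; []; _∷_)
open import Data.List.Relation.Unary.All.Properties using (all-filter)
open import Data.Nat as ℕ using (ℕ; zero; suc; _≤_; _<_; z≤n; s≤s; NonZero)
import Data.Nat.DivMod as ℕ
import Data.Nat.Properties as ℕ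
open import Data.Product using (_,_)
open import Data.Rational as ℚ using (ℚ; 0ℚ; 1ℚ; _+_; _*_; _/_) renaming (_≤_ to _≤ℚ_)
import Data.Rational.Properties as ℚ
import Data.Rational.Unnormalised as ℚᵘ
import Data.Rational.Unnormalised.Properties as ℚᵘ
open import Data.Vec.Functional using (removeAt)
open import Function using (_∘_)
open import Level using (0ℓ)
open import Relation.Binary using (_Preserves_⟶_)
open import Relation.Binary.PropositionalEquality
open import Relation.Nullary using (Dec; yes; no; ¬_)
open import Relation.Nullary.Decidable using (_×-dec_)
open import Relation.Unary using (Pred; Decidable)

ℚ-semiring : Semiring 0ℓ 0ℓ
ℚ-semiring = CommutativeRing.semiring ℚ.+-*-commutativeRing

open import Algebra.Properties.Semiring.Mult ℚ-semiring using (_×_; ×-homo-+; ×-assoc-*; ×-comm-*)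
open SemiringSum ℚ-semiring
  using (sum; sum-syntax; sum-cong-≗; sum-replicate; sum-replicate-zero; ∑-distrib-+; sum-remove)
module ℕΣ = SemiringSum ℕ.+-*-semiring

infixl 7 _when_

_when_ : ∀ {p} {P : Set p} → ℚ → Dec P → ℚ
q when yes _ = q
q when no _  = 0ℚ

𝟙 : ∀ {p} {P : Set p} → Dec P → ℕ
𝟙 (yes _) = 1
𝟙 (no _)  = 0

module _ {p} {P : Set p} where

  when-true : ∀ {q} (d : Dec P) → P → q when d ≡ q
  when-true (yes _) _  = refl
  when-true (no ¬p) p′ = ⊥-elim (¬p p′)

  when-false : ∀ {q} (d : Dec P) → ¬ P → q when d ≡ 0ℚ
  when-false (yes p′) ¬p = ⊥-elim (¬p p′)
  when-false (no _)   _  = refl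

  when≡𝟙× : ∀ (d : Dec P) q → q when d ≡ 𝟙 d × q
  when≡𝟙× (yes _) q = sym (ℚ.+-identityʳ q)
  when≡𝟙× (no _)  q = refl

  module _ {r} {R : Set r} where

    when-cong : ∀ {q q′} (d : Dec P) (e : Dec R) → q ≡ q′ → (P → R) → (R → P) → q when d ≡ q′ when e
    when-cong (yes _)  (yes _) q≡q′ _   _   = q≡q′
    when-cong (yes p′) (no ¬r) _    P→R _   = ⊥-elim (¬r (P→R p′))
    when-cong (no ¬p)  (yes r′) _   _   R→P = ⊥-elim (¬p (R→P r′))
    when-cong (no _)   (no _)  _    _   _   = refl

    when-swap : ∀ q (d : Dec P) (e : Dec R) → q when d when e ≡ q when e when d
    when-swap q (yes _) (yes _) = refl
    when-swap q (yes _) (no _)  = refl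
    when-swap q (no _)  (yes _) = refl
    when-swap q (no _)  (no _)  = refl

    when-×-dec : ∀ q (d : Dec P) (e : Dec R) → q when (d ×-dec e) ≡ q when e when d
    when-×-dec q (yes _) (yes _) = refl
    when-×-dec q (yes _) (no _)  = refl
    when-×-dec q (no _)  _       = refl

    when-mono : ∀ {q} → 0ℚ ≤ℚ q → (d : Dec P) (e : Dec R) → (P → R) → q when d ≤ℚ q when e
    when-mono _   (yes _)  (yes _) _   = ℚ.≤-refl
    when-mono _   (yes p′) (no ¬r) P→R = ⊥-elim (¬r (P→R p′))
    when-mono 0≤q (no _)   (yes _) _   = 0≤q
    when-mono _   (no _)   (no _)  _   = ℚ.≤-refl

×-nonNeg : ∀ n {q} → 0ℚ ≤ℚ q → 0ℚ ≤ℚ n × q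
×-nonNeg zero    _   = ℚ.≤-refl
×-nonNeg (suc n) 0≤q = ℚ.+-mono-≤ 0≤q (×-nonNeg n 0≤q)

×-monoˡ-≤ : ∀ {k l q} → 0ℚ ≤ℚ q → k ≤ l → k × q ≤ℚ l × q
×-monoˡ-≤ {l = l} 0≤q z≤n       = ×-nonNeg l 0≤q
×-monoˡ-≤ {q = q} 0≤q (s≤s k≤l) = ℚ.+-monoʳ-≤ q (×-monoˡ-≤ 0≤q k≤l)

-- ℚ stores reduced fractions, so the common denominator is only visible in the unnormalised form ℚᵘ.
a/d+b/d≡[a+b]/d : ∀ a b d .{{_ : NonZero d}} → + a / d + + b / d ≡ + (a ℕ.+ b) / d
a/d+b/d≡[a+b]/d a b d@(suc d-1) = ℚ.toℚᵘ-injective (begin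
  ℚ.toℚᵘ (+ a / d + + b / d)
    ≈⟨ ℚ.toℚᵘ-homo-+ (+ a / d) (+ b / d) ⟩
  ℚ.toℚᵘ (+ a / d) ℚᵘ.+ ℚ.toℚᵘ (+ b / d)
    ≈⟨ ℚᵘ.+-cong (ℚ.toℚᵘ-fromℚᵘ (ℚᵘ.mkℚᵘ (+ a) d-1)) (ℚ.toℚᵘ-fromℚᵘ (ℚᵘ.mkℚᵘ (+ b) d-1)) ⟩
  ℚᵘ.mkℚᵘ (+ a) d-1 ℚᵘ.+ ℚᵘ.mkℚᵘ (+ b) d-1
    ≈⟨ ℚᵘ.*≡* cross-multiplied ⟩
  ℚᵘ.mkℚᵘ (+ (a ℕ.+ b)) d-1
    ≈⟨ ℚ.toℚᵘ-fromℚᵘ (ℚᵘ.mkℚᵘ (+ (a ℕ.+ b)) d-1) ⟨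
  ℚ.toℚᵘ (+ (a ℕ.+ b) / d)
    ∎)
  where
  open ℚᵘ.≃-Reasoning
  distrib : ∀ x y z → (x ℤ.* z ℤ.+ y ℤ.* z) ℤ.* z ≡ (x ℤ.+ y) ℤ.* (z ℤ.* z)
  distrib = solve-∀
  cross-multiplied : (+ a ℤ.* + d ℤ.+ + b ℤ.* + d) ℤ.* + d ≡ + (a ℕ.+ b) ℤ.* + (d ℕ.* d)
  cross-multiplied = trans (distrib (+ a) (+ b) (+ d)) (sym (cong₂ ℤ._*_ (ℤ.pos-+ a b) (ℤ.pos-* d d)))

n×[1/d]≡n/d : ∀ n d .{{_ : NonZero d}} → n × (+ 1 / d) ≡ + n / d
n×[1/d]≡n/d zero    d = sym (ℚ.0/n≡0 d)
n×[1/d]≡n/d (suc n) d = trans (cong (_+_ (+ 1 / d)) (n×[1/d]≡n/d n d)) (a/d+b/d≡[a+b]/d 1 n d)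

n/n≡1 : ∀ n .{{_ : NonZero n}} → + n / n ≡ 1ℚ
n/n≡1 n@(suc n-1) =
  ℚ.fromℚᵘ-cong {ℚᵘ.mkℚᵘ (+ n) n-1} {ℚᵘ.mkℚᵘ (+ 1) 0} (ℚᵘ.*≡* (ℤ.*-comm (+ n) (+ 1)))

n×[1/n]≡1 : ∀ n .{{_ : NonZero n}} → n × (+ 1 / n) ≡ 1ℚ
n×[1/n]≡1 n = trans (n×[1/d]≡n/d n n) (n/n≡1 n)

n×1≤d×q⇒n/d≤q : ∀ {n d q} .{{_ : NonZero d}} → n × 1ℚ ≤ℚ d × q → + n / d ≤ℚ q
n×1≤d×q⇒n/d≤q {n} {d} {q} n≤dq = begin
  + n / d         ≡⟨ n×[1/d]≡n/d n d ⟨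
  n × 1/d         ≡⟨ cong (n ×_) (ℚ.*-identityˡ 1/d) ⟨
  n × (1ℚ * 1/d)  ≡⟨ ×-assoc-* n 1ℚ 1/d ⟨
  n × 1ℚ * 1/d    ≤⟨ ℚ.*-monoʳ-≤-nonNeg 1/d n≤dq ⟩
  d × q * 1/d     ≡⟨ ×-assoc-* d q 1/d ⟩
  d × (q * 1/d)   ≡⟨ ×-comm-* d q 1/d ⟨
  q * (d × 1/d)   ≡⟨ cong (q *_) (n×[1/n]≡1 d) ⟩
  q * 1ℚ          ≡⟨ ℚ.*-identityʳ q ⟩
  q               ∎
  where
  open ℚ.≤-Reasoning
  1/d : ℚ
  1/d = + 1 / d
  instance
    1/d-nonNeg : ℚ.NonNegative 1/d
    1/d-nonNeg = ℚ.normalize-nonNeg 1 d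

∑ : ∀ {a} {A : Set a} → List A → (A → ℚ) → ℚ
∑ xs g = sumℚ (map g xs)

infixl 10 ∑
syntax ∑ xs (λ x → e) = ∑[ x ∈ xs ] e

module _ {a} {A : Set a} where

  ∑-cong : ∀ (xs : List A) {g h : A → ℚ} → (∀ x → g x ≡ h x) → ∑ xs g ≡ ∑ xs h
  ∑-cong xs g≗h = cong sumℚ (List.map-cong g≗h xs)

  ∑-++ : ∀ (xs ys : List A) g → ∑ (xs ++ ys) g ≡ ∑ xs g + ∑ ys g
  ∑-++ []       ys g = sym (ℚ.+-identityˡ (∑ ys g))
  ∑-++ (x ∷ xs) ys g = trans (cong (_+_ (g x)) (∑-++ xs ys g)) (sym (ℚ.+-assoc (g x) _ _))

  ∑-filter : ∀ {p} {P : Pred A p} (P? : Decidable P) xs g →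
             ∑ (filter P? xs) g ≡ ∑[ x ∈ xs ] (g x when P? x)
  ∑-filter P? []       g = refl
  ∑-filter P? (x ∷ xs) g with P? x
  ... | yes _ = cong (_+_ (g x)) (∑-filter P? xs g)
  ... | no _  = trans (∑-filter P? xs g) (sym (ℚ.+-identityˡ _))

  ∑-mono : ∀ {xs : List A} {g h} → All (λ x → g x ≤ℚ h x) xs → ∑ xs g ≤ℚ ∑ xs h
  ∑-mono []           = ℚ.≤-refl
  ∑-mono (g≤h ∷ g≤hs) = ℚ.+-mono-≤ g≤h (∑-mono g≤hs)

  ∑-comm-sum : ∀ {m} (xs : List A) (G : Fin m → A → ℚ) →
               ∑[ x ∈ xs ] ∑[ j < m ] G j x ≡ ∑[ j < m ] ∑ xs (G j)
  ∑-comm-sum {m} []       G = sym (sum-replicate-zero m)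
  ∑-comm-sum {m} (x ∷ xs) G = trans (cong (_+_ (sum (λ j → G j x))) (∑-comm-sum xs G))
                                    (sym (∑-distrib-+ {m} (λ j → G j x) (λ j → ∑ xs (G j))))

module _ {a b} {A : Set a} {B : Set b} where

  ∑-map : ∀ (k : A → B) xs g → ∑ (map k xs) g ≡ ∑ xs (g ∘ k)
  ∑-map k xs g = cong sumℚ (sym (List.map-∘ xs))

  ∑-concatMap : ∀ (k : A → List B) xs g → ∑ (concatMap k xs) g ≡ ∑[ x ∈ xs ] ∑ (k x) g
  ∑-concatMap k []       g = refl
  ∑-concatMap k (x ∷ xs) g = trans (∑-++ (k x) _ g) (cong (_+_ (∑ (k x) g)) (∑-concatMap k xs g))

∑-tabulate : ∀ {a} {A : Set a} {n} (k : Fin n → A) g → ∑ (tabulate k) g ≡ ∑[ i < n ] g (k i)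
∑-tabulate {n = zero}  k g = refl
∑-tabulate {n = suc n} k g = cong (_+_ (g (k zero))) (∑-tabulate (k ∘ suc) g)

sum-mono : ∀ {n} {g h : Fin n → ℚ} → (∀ i → g i ≤ℚ h i) → sum g ≤ℚ sum h
sum-mono {zero}  g≤h = ℚ.≤-refl
sum-mono {suc n} g≤h = ℚ.+-mono-≤ (g≤h zero) (sum-mono (g≤h ∘ suc))

sum-when : ∀ {n p} {P : Set p} (g : Fin n → ℚ) (d : Dec P) → sum g when d ≡ ∑[ i < n ] (g i when d)
sum-when     g (yes _) = refl
sum-when {n} g (no _)  = sym (sum-replicate-zero n)

sum-when-≟ : ∀ {n} (g : Fin n → ℚ) (j : Fin n) → ∑[ i < n ] (g i when (i Fin.≟ j)) ≡ g j
sum-when-≟ {suc n} g j = begin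
  sum v                     ≡⟨ sum-remove {i = j} v ⟩
  v j + sum (removeAt v j)  ≡⟨ cong₂ _+_ (when-true (j Fin.≟ j) refl) rest≡0 ⟩
  g j + 0ℚ                  ≡⟨ ℚ.+-identityʳ (g j) ⟩
  g j                       ∎
  where
  open ≡-Reasoning
  v : Fin (suc n) → ℚ
  v i = g i when (i Fin.≟ j)
  rest≡0 : sum (removeAt v j) ≡ 0ℚ
  rest≡0 = trans (sum-cong-≗ (λ k → when-false (Fin.punchIn j k Fin.≟ j) (Fin.punchInᵢ≢i j k)))
                 (sum-replicate-zero n)

count : ∀ {n p} {P : Pred (Fin n) p} → Decidable P → ℕ
count P? = ℕΣ.sum (λ i → 𝟙 (P? i))

sum-when≡count× : ∀ {n p} {P : Pred (Fin n) p} (P? : Decidable P) q → ∑[ i < n ] (q when P? i) ≡ count P? × q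
sum-when≡count× {zero}  P? q = refl
sum-when≡count× {suc n} P? q = begin
  q when P? zero + ∑[ i < n ] (q when P? (suc i))
    ≡⟨ cong₂ _+_ (when≡𝟙× (P? zero) q) (sum-when≡count× (P? ∘ suc) q) ⟩
  𝟙 (P? zero) × q + count (P? ∘ suc) × q
    ≡⟨ ×-homo-+ q (𝟙 (P? zero)) (count (P? ∘ suc)) ⟨
  count P? × q
    ∎
  where open ≡-Reasoning

b≡𝟙[a<b]+a : ∀ {a b} → a ≤ b → b ≤ suc a → b ≡ 𝟙 (a ℕ.<? b) ℕ.+ a
b≡𝟙[a<b]+a {a} {b} a≤b b≤1+a with a ℕ.<? b
... | yes a<b = ℕ.≤-antisym b≤1+a a<b
... | no  a≮b = ℕ.≤-antisym (ℕ.≮⇒≥ a≮b) a≤b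

[m+n]/m≡1+n/m : ∀ m n .{{_ : NonZero m}} → (m ℕ.+ n) ℕ./ m ≡ suc (n ℕ./ m)
[m+n]/m≡1+n/m m n = trans (ℕ.m/n≡1+[m∸n]/n (ℕ.m≤m+n m n)) (cong (λ k → suc (k ℕ./ m)) (ℕ.m+n∸m≡n m n))

∑[j<m][a+j]/m≡a : ∀ m .{{_ : NonZero m}} a → ℕΣ.sum (λ (j : Fin m) → (a ℕ.+ toℕ j) ℕ./ m) ≡ a
∑[j<m][a+j]/m≡a m zero    =
  trans (ℕΣ.sum-cong-≗ {m} (ℕ.m<n⇒m/n≡0 ∘ Fin.toℕ<n)) (ℕΣ.sum-replicate-zero m)
-- From a to a + 1 the term ⌊a/m⌋ leaves the sum and ⌊(a + m)/m⌋ = ⌊a/m⌋ + 1 enters it.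
∑[j<m][a+j]/m≡a m (suc a) = ℕ.+-cancelˡ-≡ (g 0) _ _ (begin
  g 0 ℕ.+ ℕΣ.sum {m} (λ j → (suc a ℕ.+ toℕ j) ℕ./ m)
    ≡⟨ cong (g 0 ℕ.+_) (ℕΣ.sum-cong-≗ {m} (cong (ℕ._/ m) ∘ shift)) ⟩
  ℕΣ.sum {suc m} (g ∘ toℕ)
    ≡⟨ ℕΣ.sum-init-last (g ∘ toℕ) ⟩
  ℕΣ.sum {m} (g ∘ toℕ ∘ inject₁) ℕ.+ g (toℕ (fromℕ m))
    ≡⟨ cong₂ ℕ._+_ (ℕΣ.sum-cong-≗ {m} (cong g ∘ Fin.toℕ-inject₁)) (cong g (Fin.toℕ-fromℕ m)) ⟩
  ℕΣ.sum {m} (g ∘ toℕ) ℕ.+ g m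
    ≡⟨ cong₂ ℕ._+_ (∑[j<m][a+j]/m≡a m a) g[m]≡1+g[0] ⟩
  a ℕ.+ suc (g 0)
    ≡⟨ ℕ.+-comm a (suc (g 0)) ⟩
  suc (g 0) ℕ.+ a
    ≡⟨ ℕ.+-suc (g 0) a ⟨
  g 0 ℕ.+ suc a
    ∎)
  where
  open ≡-Reasoning
  g : ℕ → ℕ
  g k = (a ℕ.+ k) ℕ./ m
  shift : ∀ (j : Fin m) → suc a ℕ.+ toℕ j ≡ a ℕ.+ suc (toℕ j)
  shift j = sym (ℕ.+-suc a (toℕ j))
  g[m]≡1+g[0] : g m ≡ suc (g 0)
  g[m]≡1+g[0] = begin
    (a ℕ.+ m) ℕ./ m  ≡⟨ cong (ℕ._/ m) (ℕ.+-comm a m) ⟩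
    (m ℕ.+ a) ℕ./ m  ≡⟨ [m+n]/m≡1+n/m m a ⟩
    suc (a ℕ./ m)    ≡⟨ cong (λ k → suc (k ℕ./ m)) (ℕ.+-identityʳ a) ⟨
    suc (g 0)        ∎

infix 4 _≗?_

_≗?_ : ∀ {n t} (f g : Fin n → Fin t) → Dec (f ≗ g)
f ≗? g = Fin.all? (λ x → f x Fin.≟ g x)

Monotone-resp-≗ : ∀ {n t} {f g : Fin n → Fin t} → f ≗ g → Monotone f → Monotone g
Monotone-resp-≗ f≗g f-mono x y x≤y = subst₂ Fin._≤_ (f≗g x) (f≗g y) (f-mono x y x≤y)

module _ {n t : ℕ} where

  cons-cong : ∀ i {f g : Fin n → Fin t} → f ≗ g → cons i f ≗ cons i g
  cons-cong i f≗g zero    = refl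
  cons-cong i f≗g (suc x) = f≗g x

  cons-head-tail : ∀ (g : Fin (suc n) → Fin t) → cons (g zero) (g ∘ suc) ≗ g
  cons-head-tail g zero    = refl
  cons-head-tail g (suc x) = refl

  cons-≗⇒tail : ∀ {i f} {g : Fin (suc n) → Fin t} → cons i f ≗ g → f ≗ g ∘ suc
  cons-≗⇒tail eq x = eq (suc x)

  cons-≗⇒head : ∀ {i f} {g : Fin (suc n) → Fin t} → cons i f ≗ g → i ≡ g zero
  cons-≗⇒head eq = eq zero

  ≗-cons : ∀ {i f} {g : Fin (suc n) → Fin t} → f ≗ g ∘ suc → i ≡ g zero → cons i f ≗ g
  ≗-cons f≗g i≡g₀ zero    = i≡g₀
  ≗-cons f≗g i≡g₀ (suc x) = f≗g x

∑-allFuns-suc : ∀ n t (G : (Fin (suc n) → Fin t) → ℚ) →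
                ∑ (allFuns (suc n) t) G ≡ ∑[ i < t ] ∑[ f ∈ allFuns n t ] G (cons i f)
∑-allFuns-suc n t G = begin
  ∑ (concatMap (λ i → map (cons i) (allFuns n t)) (allFin t)) G
    ≡⟨ ∑-concatMap _ (allFin t) G ⟩
  ∑[ i ∈ allFin t ] ∑ (map (cons i) (allFuns n t)) G
    ≡⟨ ∑-cong (allFin t) (λ i → ∑-map (cons i) (allFuns n t) G) ⟩
  ∑[ i ∈ allFin t ] ∑[ f ∈ allFuns n t ] G (cons i f)
    ≡⟨ ∑-tabulate {n = t} (λ i → i) _ ⟩
  ∑[ i < t ] ∑[ f ∈ allFuns n t ] G (cons i f)
    ∎
  where open ≡-Reasoning

-- Maps are compared by ≗ (there is no function extensionality); allFuns lists every ≗-class exactly once.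
∑-allFuns-when-≗ : ∀ n t (g : Fin n → Fin t) (h : (Fin n → Fin t) → ℚ) → h Preserves _≗_ ⟶ _≡_ →
                   ∑[ f ∈ allFuns n t ] (h f when (f ≗? g)) ≡ h g
∑-allFuns-when-≗ zero t g h h-resp =
  trans (ℚ.+-identityʳ _) (trans (when-true ((λ ()) ≗? g) (λ ())) (h-resp (λ ())))
∑-allFuns-when-≗ (suc n) t g h h-resp = begin
  ∑[ f ∈ allFuns (suc n) t ] (h f when (f ≗? g))
    ≡⟨ ∑-allFuns-suc n t _ ⟩
  ∑[ i < t ] ∑[ f ∈ allFuns n t ] (h (cons i f) when (cons i f ≗? g))
    ≡⟨ sum-cong-≗ (λ i → ∑-cong (allFuns n t) (split i)) ⟩
  ∑[ i < t ] ∑[ f ∈ allFuns n t ] (hᵢ i f when (f ≗? g ∘ suc))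
    ≡⟨ sum-cong-≗ (λ i → ∑-allFuns-when-≗ n t (g ∘ suc) (hᵢ i) (hᵢ-resp i)) ⟩
  ∑[ i < t ] (h (cons i (g ∘ suc)) when (i Fin.≟ g zero))
    ≡⟨ sum-when-≟ (λ i → h (cons i (g ∘ suc))) (g zero) ⟩
  h (cons (g zero) (g ∘ suc))
    ≡⟨ h-resp (cons-head-tail g) ⟩
  h g
    ∎
  where
  open ≡-Reasoning
  hᵢ : Fin t → (Fin n → Fin t) → ℚ
  hᵢ i f = h (cons i f) when (i Fin.≟ g zero)
  hᵢ-resp : ∀ i → hᵢ i Preserves _≗_ ⟶ _≡_
  hᵢ-resp i f≗f′ = cong (_when (i Fin.≟ g zero)) (h-resp (cons-cong i f≗f′))
  split : ∀ i f → h (cons i f) when (cons i f ≗? g) ≡ hᵢ i f when (f ≗? g ∘ suc)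
  split i f = trans
    (when-cong (cons i f ≗? g) (f ≗? g ∘ suc ×-dec i Fin.≟ g zero) refl
      (λ eq → cons-≗⇒tail eq , cons-≗⇒head eq) (λ (f≗g , i≡g₀) → ≗-cons f≗g i≡g₀))
    (when-×-dec (h (cons i f)) (f ≗? g ∘ suc) (i Fin.≟ g zero))

∑-monoFuns-when-≗ : ∀ {n t} {g : Fin n → Fin t} → Monotone g →
                    (h : (Fin n → Fin t) → ℚ) → h Preserves _≗_ ⟶ _≡_ →
                    ∑[ f ∈ monoFuns n t ] (h f when (f ≗? g)) ≡ h g
∑-monoFuns-when-≗ {n} {t} {g} g-mono h h-resp = begin
  ∑[ f ∈ monoFuns n t ] (h f when (f ≗? g))                 ≡⟨ ∑-filter monotone? (allFuns n t) _ ⟩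
  ∑[ f ∈ allFuns n t ] (h f when (f ≗? g) when monotone? f) ≡⟨ ∑-cong (allFuns n t) swap ⟩
  ∑[ f ∈ allFuns n t ] (h f when monotone? f when (f ≗? g)) ≡⟨ ∑-allFuns-when-≗ n t g _ h′-resp ⟩
  h g when monotone? g                                      ≡⟨ when-true (monotone? g) g-mono ⟩
  h g                                                       ∎
  where
  open ≡-Reasoning
  swap : ∀ f → h f when (f ≗? g) when monotone? f ≡ h f when monotone? f when (f ≗? g)
  swap f = when-swap (h f) (f ≗? g) (monotone? f)
  h′-resp : (λ f → h f when monotone? f) Preserves _≗_ ⟶ _≡_
  h′-resp {f} {f′} f≗f′ = when-cong (monotone? f) (monotone? f′) (h-resp f≗f′)
                            (Monotone-resp-≗ f≗f′) (Monotone-resp-≗ (sym ∘ f≗f′))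

-- Lower bound

ascent? : ∀ {n t} (f : Fin (suc n) → Fin t) (i : Fin n) → Dec (f (inject₁ i) Fin.< f (suc i))
ascent? f i = f (inject₁ i) Fin.<? f (suc i)

ascents : ∀ {n t} → (Fin (suc n) → Fin t) → ℕ
ascents f = count (ascent? f)

𝟙[a<b]+a≤b : ∀ {t} {a b : Fin t} → a Fin.≤ b → 𝟙 (a Fin.<? b) ℕ.+ toℕ a ≤ toℕ b
𝟙[a<b]+a≤b {a = a} {b} a≤b with a Fin.<? b
... | yes a<b = a<b
... | no _    = a≤b

ascents+head≤last : ∀ {n t} (f : Fin (suc n) → Fin t) → Monotone f →
                    ascents f ℕ.+ toℕ (f zero) ≤ toℕ (f (fromℕ n))
ascents+head≤last {zero}  f _      = ℕ.≤-refl
ascents+head≤last {suc n} f f-mono = begin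
  (a₀ ℕ.+ ascents (f ∘ suc)) ℕ.+ toℕ (f zero)  ≡⟨ cong (ℕ._+ toℕ (f zero)) (ℕ.+-comm a₀ _) ⟩
  (ascents (f ∘ suc) ℕ.+ a₀) ℕ.+ toℕ (f zero)  ≡⟨ ℕ.+-assoc (ascents (f ∘ suc)) a₀ _ ⟩
  ascents (f ∘ suc) ℕ.+ (a₀ ℕ.+ toℕ (f zero))  ≤⟨ ℕ.+-monoʳ-≤ _ (𝟙[a<b]+a≤b (f-mono zero (suc zero) z≤n)) ⟩
  ascents (f ∘ suc) ℕ.+ toℕ (f (suc zero))     ≤⟨ ascents+head≤last (f ∘ suc) tail-mono ⟩
  toℕ (f (fromℕ (suc n)))                      ∎
  where
  open ℕ.≤-Reasoning
  a₀ : ℕ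
  a₀ = 𝟙 (ascent? f zero)
  tail-mono : Monotone (f ∘ suc)
  tail-mono x y x≤y = f-mono (suc x) (suc y) (s≤s x≤y)

ascents≤s : ∀ {m s} (f : Fin (suc m) → Fin (suc s)) → Monotone f → ascents f ≤ s
ascents≤s f f-mono =
  ℕ.≤-trans (ℕ.m≤m+n _ _) (ℕ.≤-trans (ascents+head≤last f f-mono) (ℕ.s≤s⁻¹ (Fin.toℕ<n _)))

suc≰inject₁ : ∀ {n} (i : Fin n) → ¬ (suc i Fin.≤ inject₁ i)
suc≰inject₁ i = ℕ.<⇒≱ (Fin.≤̄⇒inject₁< ℕ.≤-refl)

m×1≤s×totalWeight : ∀ {m s} (w : Weighting (suc m) (suc s)) → IsFracRealiser (suc m) (suc s) w →
                    m × 1ℚ ≤ℚ s × totalWeight w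
m×1≤s×totalWeight {m} {s} w (w≥0 , w-separates) = begin
  m × 1ℚ                                        ≡⟨ sum-replicate m ⟨
  ∑[ i < m ] 1ℚ                                 ≤⟨ sum-mono (λ i → w-separates _ _ (suc≰inject₁ i)) ⟩
  ∑[ i < m ] weightSep w (inject₁ i) (suc i)    ≡⟨ sum-cong-≗ (λ i → ∑-filter (λ f → ascent? f i) M w) ⟩
  ∑[ i < m ] ∑[ f ∈ M ] (w f when ascent? f i)  ≡⟨ ∑-comm-sum M (λ i f → w f when ascent? f i) ⟨
  ∑[ f ∈ M ] ∑[ i < m ] (w f when ascent? f i)  ≡⟨ ∑-cong M (λ f → sum-when≡count× (ascent? f) (w f)) ⟩
  ∑[ f ∈ M ] (ascents f × w f)                  ≤⟨ ∑-mono (All.map bound (all-filter monotone? (allFuns _ _))) ⟩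
  ∑[ f ∈ M ] (s × w f)                          ≡⟨ ∑-cong M (λ f → sum-replicate s {w f}) ⟨
  ∑[ f ∈ M ] ∑[ _ < s ] w f                     ≡⟨ ∑-comm-sum {m = s} M (λ _ → w) ⟩
  ∑[ _ < s ] totalWeight w                      ≡⟨ sum-replicate s ⟩
  s × totalWeight w                             ∎
  where
  open ℚ.≤-Reasoning
  M : List (Fin (suc m) → Fin (suc s))
  M = monoFuns (suc m) (suc s)
  bound : ∀ {f} → Monotone f → ascents f × w f ≤ℚ s × w f
  bound f-mono = ×-monoˡ-≤ (w≥0 _ f-mono) (ascents≤s _ f-mono)

-- Upper bound: staircase maps

module Staircase (m s : ℕ) .{{_ : NonZero m}} .{{_ : NonZero s}} (s≤m : s ≤ m) where

  stairℕ : ℕ → ℕ → ℕ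
  stairℕ j x = (x ℕ.* s ℕ.+ j) ℕ./ m

  stairℕ-mono : ∀ j {x y} → x ≤ y → stairℕ j x ≤ stairℕ j y
  stairℕ-mono j x≤y = ℕ./-monoˡ-≤ m (ℕ.+-monoˡ-≤ j (ℕ.*-monoˡ-≤ s x≤y))

  stairℕ-suc≤ : ∀ j x → stairℕ j (suc x) ≤ suc (stairℕ j x)
  stairℕ-suc≤ j x = begin
    (s ℕ.+ x ℕ.* s ℕ.+ j) ℕ./ m    ≡⟨ cong (ℕ._/ m) (ℕ.+-assoc s (x ℕ.* s) j) ⟩
    (s ℕ.+ (x ℕ.* s ℕ.+ j)) ℕ./ m  ≤⟨ ℕ./-monoˡ-≤ m (ℕ.+-monoˡ-≤ _ s≤m) ⟩
    (m ℕ.+ (x ℕ.* s ℕ.+ j)) ℕ./ m  ≡⟨ [m+n]/m≡1+n/m m _ ⟩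
    suc (stairℕ j x)               ∎
    where open ℕ.≤-Reasoning

  stairℕ<1+s : ∀ {j x} → j < m → x ≤ m → stairℕ j x < suc s
  stairℕ<1+s {j} {x} j<m x≤m = ℕ.m<n*o⇒m/o<n (begin-strict
    x ℕ.* s ℕ.+ j  <⟨ ℕ.+-mono-≤-< (ℕ.*-monoˡ-≤ s x≤m) j<m ⟩
    m ℕ.* s ℕ.+ m  ≡⟨ ℕ.+-comm (m ℕ.* s) m ⟩
    m ℕ.+ m ℕ.* s  ≡⟨ cong (m ℕ.+_) (ℕ.*-comm m s) ⟩
    suc s ℕ.* m    ∎)
    where open ℕ.≤-Reasoning

  ∑-stairℕ : ∀ x → ℕΣ.sum (λ (j : Fin m) → stairℕ (toℕ j) x) ≡ x ℕ.* s
  ∑-stairℕ x = ∑[j<m][a+j]/m≡a m (x ℕ.* s)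

  rises? : ∀ x (j : Fin m) → Dec (stairℕ (toℕ j) x < stairℕ (toℕ j) (suc x))
  rises? x j = stairℕ (toℕ j) x ℕ.<? stairℕ (toℕ j) (suc x)

  count-rises≡s : ∀ x → count (rises? x) ≡ s
  count-rises≡s x = ℕ.+-cancelʳ-≡ (x ℕ.* s) _ _ (begin
    count (rises? x) ℕ.+ x ℕ.* s                              ≡⟨ cong (count (rises? x) ℕ.+_) (∑-stairℕ x) ⟨
    count (rises? x) ℕ.+ ℕΣ.sum {m} (λ j → stairℕ (toℕ j) x)  ≡⟨ ℕΣ.∑-distrib-+ (𝟙 ∘ rises? x) _ ⟨
    ℕΣ.sum {m} (λ j → 𝟙 (rises? x j) ℕ.+ stairℕ (toℕ j) x)    ≡⟨ ℕΣ.sum-cong-≗ {m} step ⟨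
    ℕΣ.sum {m} (λ j → stairℕ (toℕ j) (suc x))                 ≡⟨ ∑-stairℕ (suc x) ⟩
    s ℕ.+ x ℕ.* s                                             ∎)
    where
    open ≡-Reasoning
    step : ∀ (j : Fin m) → stairℕ (toℕ j) (suc x) ≡ 𝟙 (rises? x j) ℕ.+ stairℕ (toℕ j) x
    step j = b≡𝟙[a<b]+a (stairℕ-mono (toℕ j) (ℕ.n≤1+n x)) (stairℕ-suc≤ (toℕ j) x)

  stair : Fin m → Fin (suc m) → Fin (suc s)
  stair j x = fromℕ< (stairℕ<1+s (Fin.toℕ<n j) (ℕ.s≤s⁻¹ (Fin.toℕ<n x)))

  toℕ-stair : ∀ j x → toℕ (stair j x) ≡ stairℕ (toℕ j) (toℕ x)
  toℕ-stair j x = Fin.toℕ-fromℕ< _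

  stair-monotone : ∀ j → Monotone (stair j)
  stair-monotone j x y x≤y = subst₂ _≤_ (sym (toℕ-stair j x)) (sym (toℕ-stair j y)) (stairℕ-mono (toℕ j) x≤y)

  1/s : ℚ
  1/s = + 1 / s

  1/s≥0 : 0ℚ ≤ℚ 1/s
  1/s≥0 = ℚ.nonNegative⁻¹ 1/s {{ℚ.normalize-nonNeg 1 s}}

  stairWeighting : Weighting (suc m) (suc s)
  stairWeighting f = ∑[ j < m ] (1/s when (f ≗? stair j))

  M : List (Fin (suc m) → Fin (suc s))
  M = monoFuns (suc m) (suc s)

  stairWeighting-nonNeg : ∀ f → Monotone f → 0ℚ ≤ℚ stairWeighting f
  stairWeighting-nonNeg f _ =
    subst (0ℚ ≤ℚ_) (sym (sum-when≡count× (_≗?_ f ∘ stair) 1/s)) (×-nonNeg (count (_≗?_ f ∘ stair)) 1/s≥0)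

  totalWeight-stairWeighting : totalWeight stairWeighting ≡ + m / s
  totalWeight-stairWeighting = begin
    ∑[ f ∈ M ] ∑[ j < m ] (1/s when (f ≗? stair j))
      ≡⟨ ∑-comm-sum M (λ j f → 1/s when (f ≗? stair j)) ⟩
    ∑[ j < m ] ∑[ f ∈ M ] (1/s when (f ≗? stair j))
      ≡⟨ sum-cong-≗ (λ j → ∑-monoFuns-when-≗ (stair-monotone j) _ (λ _ → refl)) ⟩
    ∑[ j < m ] 1/s
      ≡⟨ sum-replicate m ⟩
    m × 1/s
      ≡⟨ n×[1/d]≡n/d m s ⟩
    + m / s
      ∎
    where open ≡-Reasoning

  weightSep-stairWeighting : ∀ x y →
                             weightSep stairWeighting x y ≡ ∑[ j < m ] (1/s when (stair j x Fin.<? stair j y))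
  weightSep-stairWeighting x y = begin
    weightSep stairWeighting x y
      ≡⟨ ∑-filter lt M stairWeighting ⟩
    ∑[ f ∈ M ] (stairWeighting f when lt f)
      ≡⟨ ∑-cong M (λ f → sum-when (λ j → 1/s when (f ≗? stair j)) (lt f)) ⟩
    ∑[ f ∈ M ] ∑[ j < m ] (1/s when (f ≗? stair j) when lt f)
      ≡⟨ ∑-comm-sum M (λ j f → 1/s when (f ≗? stair j) when lt f) ⟩
    ∑[ j < m ] ∑[ f ∈ M ] (1/s when (f ≗? stair j) when lt f)
      ≡⟨ sum-cong-≗ (λ j → ∑-cong M (λ f → when-swap 1/s (f ≗? stair j) (lt f))) ⟩
    ∑[ j < m ] ∑[ f ∈ M ] (1/s when lt f when (f ≗? stair j))
      ≡⟨ sum-cong-≗ (λ j → ∑-monoFuns-when-≗ (stair-monotone j) _ lt-resp) ⟩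
    ∑[ j < m ] (1/s when lt (stair j))
      ∎
    where
    open ≡-Reasoning
    lt : ∀ (f : Fin (suc m) → Fin (suc s)) → Dec (f x Fin.< f y)
    lt f = f x Fin.<? f y
    lt-resp : (λ f → 1/s when lt f) Preserves _≗_ ⟶ _≡_
    lt-resp {f} {f′} f≗f′ = when-cong (lt f) (lt f′) refl
      (subst₂ Fin._<_ (f≗f′ x) (f≗f′ y)) (subst₂ Fin._<_ (sym (f≗f′ x)) (sym (f≗f′ y)))

  stairWeighting-separates : ∀ x y → ¬ (y Fin.≤ x) → 1ℚ ≤ℚ weightSep stairWeighting x y
  stairWeighting-separates x y y≰x = begin
    1ℚ                                                  ≡⟨ n×[1/n]≡1 s ⟨
    s × 1/s                                             ≡⟨ cong (_× 1/s) (count-rises≡s (toℕ x)) ⟨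
    count (rises? (toℕ x)) × 1/s                        ≡⟨ sum-when≡count× (rises? (toℕ x)) 1/s ⟨
    ∑[ j < m ] (1/s when rises? (toℕ x) j)              ≤⟨ sum-mono rise≤lt ⟩
    ∑[ j < m ] (1/s when (stair j x Fin.<? stair j y))  ≡⟨ weightSep-stairWeighting x y ⟨
    weightSep stairWeighting x y                        ∎
    where
    open ℚ.≤-Reasoning
    lt : ∀ (j : Fin m) → Dec (stair j x Fin.< stair j y)
    lt j = stair j x Fin.<? stair j y
    rise⇒lt : ∀ j → stairℕ (toℕ j) (toℕ x) < stairℕ (toℕ j) (suc (toℕ x)) → stair j x Fin.< stair j y
    rise⇒lt j rise = subst₂ _<_ (sym (toℕ-stair j x)) (sym (toℕ-stair j y))
                       (ℕ.<-≤-trans rise (stairℕ-mono (toℕ j) (ℕ.≰⇒> y≰x)))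
    rise≤lt : ∀ j → 1/s when rises? (toℕ x) j ≤ℚ 1/s when lt j
    rise≤lt j = when-mono 1/s≥0 (rises? (toℕ x) j) (lt j) (rise⇒lt j)

theorem9 : (n t : ℕ) (h : 2 ≤ t) → t ≤ n → IsFdim n t (ratio n t h)
theorem9 (suc (suc m)) (suc (suc s)) (s≤s (s≤s z≤n)) (s≤s 1+s≤1+m) =
  (stairWeighting , (stairWeighting-nonNeg , stairWeighting-separates) , totalWeight-stairWeighting) ,
  λ w w-realiser → n×1≤d×q⇒n/d≤q {suc m} {suc s} (m×1≤s×totalWeight w w-realiser)
  where open Staircase (suc m) (suc s) 1+s≤1+m
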